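{- Let $j,k$ be integers with $k+250<j<3k/2$, $j\ge 212299$ and $k\ge 141534$. Let $G$ be a complete graph on $4j+1$ vertices whose edges are colored red and blue such that the red subgraph contains no cycle $C_{2k+1}$ and the blue subgraph contains no wheel $W_{2j}$. Let $v$ be a vertex of $G$ of maximum blue degree and let $H$ be the subgraph induced on the blue neighborhood $N^B(v)$. Let $a,b$ be vertices of $H$ joined by a red edge, each having fewer than $j$ blue neighbors in $H$. Let $C$ be a red cycle of length $2j-502$ in $H-a-b$, with vertices labeled by $\mathbb{Z}/(2j-502)\mathbb{Z}$ so that $i$ and $i+1$ are consecutive on $C$. For each label $i$ set $A_i=1$ if the edge $ai$ is red and $A_i=0$ if blue, and $B_i=1$ if $bi$ is red and $B_i=0$ if blue. Then $|\{x: A_x=B_{x+2k-2}\}|\le 500$ and $|\{x: B_x=A_{x+2k-2}\}|\le 500$.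
   Context: $C_m$ is the cycle of length $m$; the wheel $W_{n}$ consists of a cycle $C_n$ together with a hub vertex adjacent to all cycle vertices. Indices of labels are taken modulo $2j-502$. -}

module Defs where

open import Data.Nat using (ℕ; zero; suc; _+_; _<_; _%_)
open import Data.Nat.DivMod using (m%n<n)
open import Data.Fin using (Fin; toℕ; fromℕ<) renaming (zero to fz; suc to fs)
open import Data.Fin.Properties using (_≟_)
open import Data.Bool using (Bool; true; false; _∧_; not; if_then_else_)
open import Relation.Nullary using (¬_)
open import Relation.Nullary.Decidable using (⌊_⌋)
open import Relation.Binary.PropositionalEquality using (_≡_)
open import Function.Definitions using (Injective)

data Colour : Set where
  red blue : Colour

isRed : Colour → Bool
isRed red = true
isRed blue = false

isBlue : Colour → Bool
isBlue c = not (isRed c)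

count : ∀ {n} → (Fin n → Bool) → ℕ
count {zero} P = 0
count {suc n} P = (if P fz then 1 else 0) + count (λ i → P (fs i))

shiftBy : ∀ {n} → ℕ → Fin n → Fin n
shiftBy {suc n} d i = fromℕ< (m%n<n (toℕ i + d) (suc n))

-- a red/blue edge colouring of the complete graph K_N on vertex set Fin N
-- (the value on the diagonal is irrelevant and never used)
record Colouring (N : ℕ) : Set where
  field
    col  : Fin N → Fin N → Colour
    symm : ∀ u v → col u v ≡ col v u
open Colouring public

record CycleIn {N : ℕ} (G : Colouring N) (c : Colour) (m : ℕ) : Set where
  field
    vtx : Fin m → Fin N
    inj : Injective _≡_ _≡_ vtx
    adj : ∀ i → col G (vtx i) (vtx (shiftBy 1 i)) ≡ c
open CycleIn public

record WheelIn {N : ℕ} (G : Colouring N) (c : Colour) (m : ℕ) : Set where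
  field
    hub   : Fin N
    rim   : CycleIn G c m
    hub≢  : ∀ i → ¬ (vtx rim i ≡ hub)
    spoke : ∀ i → col G hub (vtx rim i) ≡ c
open WheelIn public

blueAdj : ∀ {N} → Colouring N → Fin N → Fin N → Bool
blueAdj G v u = not ⌊ u ≟ v ⌋ ∧ isBlue (col G v u)

blueDeg : ∀ {N} → Colouring N → Fin N → ℕ
blueDeg G v = count (blueAdj G v)

blueDegInNB : ∀ {N} → Colouring N → (v a : Fin N) → ℕ
blueDegInNB G v a = count (λ u → blueAdj G v u ∧ blueAdj G a u)

eqB : Bool → Bool → Bool
eqB true y = y
eqB false y = not y

-- If a is red to C_x and b is red to C_{x+d}, the arc C_x C_{x+1} ⋯ C_{x+d} of the red
-- cycle C closes up through b and a to a red cycle of length d + 3.  For d = 2k − 2 this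
-- is a forbidden red C_{2k+1}, so for every x one of the edges a C_x, b C_{x+d} is blue.
-- Hence each of the 2j − 502 labels contributes a blue edge from a or b into N^B(v), and
-- each agreement (both edges blue) contributes two, so
--   #agreements + (2j − 502) ≤ deg_a + deg_b ≤ 2j − 2.
module Submission where

open import Defs
open import Data.Nat using (ℕ; zero; suc; _+_; _*_; _∸_; _%_; _≤_; _<_; _≥_; z≤n; s≤s)
open import Data.Nat.Properties
open import Data.Nat.DivMod using (m%n<n; m<n⇒m%n≡m; n%n≡0; m%n%n≡m%n; %-distribˡ-+; %-remove-+ʳ)
open import Data.Nat.Divisibility using (_∣_; m∣m*n; _∣0)
open import Data.Nat.Tactic.RingSolver using (solve)
open import Data.Fin using (Fin; toℕ; fromℕ; fromℕ<; inject₁) renaming (zero to fz; suc to fs)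
open import Data.Fin.Properties
  using (toℕ-injective; toℕ-fromℕ<; toℕ<n; toℕ-fromℕ; toℕ-inject₁; toℕ≤pred[n]; fromℕ<-injective)
  renaming (suc-injective to fs-injective; _≟_ to _≟ᶠ_)
open import Data.Bool using (Bool; true; false; not; _∧_; _∨_; if_then_else_)
open import Data.Bool.Properties using (∧-identityʳ; ∧-zeroʳ)
open import Data.List using (_∷_; [])
open import Data.Product using (_×_; _,_)
open import Data.Empty using (⊥-elim)
open import Relation.Nullary using (¬_; does)
open import Relation.Nullary.Decidable using (dec-false; dec-no)
open import Relation.Binary.PropositionalEquality
  using (_≡_; refl; sym; trans; cong; cong₂; subst; module ≡-Reasoning)
open import Function.Definitions using (Injective)
open import Algebra.Properties.CommutativeSemigroup +-commutativeSemigroup using (x∙yz≈y∙xz)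

[_] : Bool → ℕ
[ b ] = if b then 1 else 0

count-cong : ∀ {n} {P Q : Fin n → Bool} → (∀ x → P x ≡ Q x) → count P ≡ count Q
count-cong {zero}  P≗Q = refl
count-cong {suc n} {P} {Q} P≗Q rewrite P≗Q fz = cong ([ Q fz ] +_) (count-cong (λ x → P≗Q (fs x)))

count-all : ∀ {n} {P : Fin n → Bool} → (∀ x → P x ≡ true) → count P ≡ n
count-all {zero}  all = refl
count-all {suc n} all rewrite all fz = cong suc (count-all (λ x → all (fs x)))

count-remove : ∀ {n} (P : Fin n → Bool) (y : Fin n) →
  count P ≡ [ P y ] + count (λ x → P x ∧ not (does (x ≟ᶠ y)))
count-remove {suc n} P fz rewrite ∧-zeroʳ (P fz) =
  cong ([ P fz ] +_) (count-cong {n} (λ x → sym (∧-identityʳ (P (fs x)))))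
count-remove {suc n} P (fs y) rewrite ∧-identityʳ (P fz) | count-remove (λ x → P (fs x)) y =
  x∙yz≈y∙xz [ P fz ] [ P (fs y) ] _

[]-mono : ∀ {b b′} → (b ≡ true → b′ ≡ true) → [ b ] ≤ [ b′ ]
[]-mono {false} b⇒b′ = z≤n
[]-mono {true}  b⇒b′ rewrite b⇒b′ refl = ≤-refl

count-≤-injective : ∀ {m n} (f : Fin m → Fin n) → Injective _≡_ _≡_ f →
  {P : Fin m → Bool} {Q : Fin n → Bool} → (∀ x → P x ≡ true → Q (f x) ≡ true) → count P ≤ count Q
count-≤-injective {zero}  f f-inj P⇒Q = z≤n
count-≤-injective {suc m} f f-inj {P} {Q} P⇒Q = begin
  [ P fz ] + count (λ x → P (fs x))                        ≤⟨ +-mono-≤ ([]-mono (P⇒Q fz)) ih ⟩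
  [ Q (f fz) ] + count (λ u → Q u ∧ not (does (u ≟ᶠ f fz))) ≡⟨ count-remove Q (f fz) ⟨
  count Q                                                   ∎
  where
  open ≤-Reasoning
  f-fs≢f-fz : ∀ x → ¬ f (fs x) ≡ f fz
  f-fs≢f-fz x e with f-inj e
  ... | ()
  ih : count (λ x → P (fs x)) ≤ count (λ u → Q u ∧ not (does (u ≟ᶠ f fz)))
  ih = count-≤-injective (λ x → f (fs x)) (λ e → fs-injective (f-inj e)) λ x Px →
    subst (λ q → q ∧ not (does (f (fs x) ≟ᶠ f fz)) ≡ true) (sym (P⇒Q (fs x) Px))
      (cong not (dec-false (f (fs x) ≟ᶠ f fz) (f-fs≢f-fz x)))

+-suc-cong : ∀ {a o p q} → a + o ≡ p + q → a + suc o ≡ p + suc q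
+-suc-cong {a} {o} {p} {q} e = trans (+-suc a o) (trans (cong suc e) (sym (+-suc p q)))

count-∧+count-∨ : ∀ {n} (P Q : Fin n → Bool) →
  count (λ x → P x ∧ Q x) + count (λ x → P x ∨ Q x) ≡ count P + count Q
count-∧+count-∨ {zero}  P Q = refl
count-∧+count-∨ {suc n} P Q with P fz | Q fz | count-∧+count-∨ (λ x → P (fs x)) (λ x → Q (fs x))
... | true  | true  | ih = cong suc (+-suc-cong ih)
... | true  | false | ih = trans (+-suc _ _) (cong suc ih)
... | false | true  | ih = +-suc-cong ih
... | false | false | ih = ih

eqB-disjoint : ∀ p q → p ∧ q ≡ false → eqB p q ≡ not p ∧ not q
eqB-disjoint true  true  ()
eqB-disjoint true  false _ = refl
eqB-disjoint false q     _ = refl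

not∨not-disjoint : ∀ p q → p ∧ q ≡ false → not p ∨ not q ≡ true
not∨not-disjoint true  true  ()
not∨not-disjoint true  false _ = refl
not∨not-disjoint false q     _ = refl

count-eqB-disjoint : ∀ {n} (P Q : Fin n → Bool) → (∀ x → P x ∧ Q x ≡ false) →
  count (λ x → eqB (P x) (Q x)) + n ≡ count (λ x → not (P x)) + count (λ x → not (Q x))
count-eqB-disjoint {n} P Q disjoint = begin
  count (λ x → eqB (P x) (Q x)) + n
    ≡⟨ cong₂ _+_ (count-cong (λ x → eqB-disjoint (P x) (Q x) (disjoint x)))
                 (sym (count-all (λ x → not∨not-disjoint (P x) (Q x) (disjoint x)))) ⟩
  count (λ x → not (P x) ∧ not (Q x)) + count (λ x → not (P x) ∨ not (Q x))
    ≡⟨ count-∧+count-∨ (λ x → not (P x)) (λ x → not (Q x)) ⟩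
  count (λ x → not (P x)) + count (λ x → not (Q x)) ∎
  where open ≡-Reasoning

toℕ-shiftBy : ∀ {n} d (i : Fin (suc n)) → toℕ (shiftBy d i) ≡ (toℕ i + d) % suc n
toℕ-shiftBy {n} d i = toℕ-fromℕ< (m%n<n (toℕ i + d) (suc n))

shiftBy-periodic : ∀ {n} k (i : Fin (suc n)) → suc n ∣ k → shiftBy k i ≡ i
shiftBy-periodic k i n+1∣k = toℕ-injective (begin
  toℕ (shiftBy k i)   ≡⟨ toℕ-shiftBy k i ⟩
  (toℕ i + k) % _     ≡⟨ %-remove-+ʳ (toℕ i) n+1∣k ⟩
  toℕ i % _           ≡⟨ m<n⇒m%n≡m (toℕ<n i) ⟩
  toℕ i               ∎)
  where open ≡-Reasoning

shiftBy-+ : ∀ {n} s t (i : Fin (suc n)) → shiftBy s (shiftBy t i) ≡ shiftBy (t + s) i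
shiftBy-+ {n} s t i = toℕ-injective (begin
  toℕ (shiftBy s (shiftBy t i))      ≡⟨ toℕ-shiftBy s (shiftBy t i) ⟩
  (toℕ (shiftBy t i) + s) % M        ≡⟨ cong (λ r → (r + s) % M) (toℕ-shiftBy t i) ⟩
  ((toℕ i + t) % M + s) % M          ≡⟨ %-distribˡ-+ ((toℕ i + t) % M) s M ⟩
  ((toℕ i + t) % M % M + s % M) % M  ≡⟨ cong (λ r → (r + s % M) % M) (m%n%n≡m%n (toℕ i + t) M) ⟩
  ((toℕ i + t) % M + s % M) % M      ≡⟨ %-distribˡ-+ (toℕ i + t) s M ⟨
  (toℕ i + t + s) % M                ≡⟨ cong (_% M) (+-assoc (toℕ i) t s) ⟩
  (toℕ i + (t + s)) % M              ≡⟨ toℕ-shiftBy (t + s) i ⟨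
  toℕ (shiftBy (t + s) i)            ∎)
  where
  open ≡-Reasoning
  M = suc n

shiftBy-0 : ∀ {n} (i : Fin (suc n)) → shiftBy 0 i ≡ i
shiftBy-0 i = shiftBy-periodic 0 i (_ ∣0)

-- Shifting by d and then by n·d is shifting by (1 + n)·d, a multiple of the length.
shiftBy-inverse : ∀ {n} d (i : Fin (suc n)) → shiftBy (n * d) (shiftBy d i) ≡ i
shiftBy-inverse {n} d i = trans (shiftBy-+ (n * d) d i) (shiftBy-periodic (suc n * d) i (m∣m*n d))

shiftBy-injective : ∀ {n} d → Injective _≡_ _≡_ (shiftBy {suc n} d)
shiftBy-injective {n} d {i} {i′} e =
  trans (sym (shiftBy-inverse d i)) (trans (cong (shiftBy (n * d)) e) (shiftBy-inverse d i′))

shiftBy-comm : ∀ {n} {t} (t<n : t < suc n) (i : Fin (suc n)) → shiftBy t i ≡ shiftBy (toℕ i) (fromℕ< t<n)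
shiftBy-comm {n} {t} t<n i = toℕ-injective (begin
  toℕ (shiftBy t i)                      ≡⟨ toℕ-shiftBy t i ⟩
  (toℕ i + t) % suc n                    ≡⟨ cong (_% suc n) (+-comm (toℕ i) t) ⟩
  (t + toℕ i) % suc n                    ≡⟨ cong (λ r → (r + toℕ i) % suc n) (toℕ-fromℕ< t<n) ⟨
  (toℕ (fromℕ< t<n) + toℕ i) % suc n     ≡⟨ toℕ-shiftBy (toℕ i) (fromℕ< t<n) ⟨
  toℕ (shiftBy (toℕ i) (fromℕ< t<n))     ∎)
  where open ≡-Reasoning

shiftBy-injectiveˡ : ∀ {n} {t t′} (i : Fin (suc n)) → t < suc n → t′ < suc n →
  shiftBy t i ≡ shiftBy t′ i → t ≡ t′
shiftBy-injectiveˡ {t = t} {t′} i t<n t′<n e = fromℕ<-injective t t′ t<n t′<n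
  (shiftBy-injective (toℕ i) (trans (sym (shiftBy-comm t<n i)) (trans e (shiftBy-comm t′<n i))))

shiftBy-1-inject₁ : ∀ {n} (i : Fin n) → shiftBy 1 (inject₁ i) ≡ fs i
shiftBy-1-inject₁ {n} i = toℕ-injective (begin
  toℕ (shiftBy 1 (inject₁ i))    ≡⟨ toℕ-shiftBy 1 (inject₁ i) ⟩
  (toℕ (inject₁ i) + 1) % suc n  ≡⟨ cong (λ r → (r + 1) % suc n) (toℕ-inject₁ i) ⟩
  (toℕ i + 1) % suc n            ≡⟨ cong (_% suc n) (+-comm (toℕ i) 1) ⟩
  suc (toℕ i) % suc n            ≡⟨ m<n⇒m%n≡m (s≤s (toℕ<n i)) ⟩
  suc (toℕ i)                    ∎)
  where open ≡-Reasoning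

shiftBy-1-fromℕ : ∀ n → shiftBy 1 (fromℕ n) ≡ fz
shiftBy-1-fromℕ n = toℕ-injective (begin
  toℕ (shiftBy 1 (fromℕ n))    ≡⟨ toℕ-shiftBy 1 (fromℕ n) ⟩
  (toℕ (fromℕ n) + 1) % suc n  ≡⟨ cong (λ r → (r + 1) % suc n) (toℕ-fromℕ n) ⟩
  (n + 1) % suc n              ≡⟨ cong (_% suc n) (+-comm n 1) ⟩
  suc n % suc n                ≡⟨ n%n≡0 (suc n) ⟩
  0                            ∎)
  where open ≡-Reasoning

data InjectView : ∀ {n} → Fin (suc n) → Set where
  last   : ∀ {n} → InjectView (fromℕ n)
  inject : ∀ {n} (i : Fin n) → InjectView (inject₁ i)

injectView : ∀ {n} (i : Fin (suc n)) → InjectView i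
injectView {zero}  fz     = last
injectView {suc n} fz     = inject fz
injectView {suc n} (fs i) with injectView i
... | last     = last
... | inject j = inject (fs j)

cycle-intro : ∀ {N n c} {G : Colouring N} (f : Fin (suc n) → Fin N) → Injective _≡_ _≡_ f →
  (∀ i → col G (f (inject₁ i)) (f (fs i)) ≡ c) → col G (f (fromℕ n)) (f fz) ≡ c → CycleIn G c (suc n)
cycle-intro {n = n} {c} {G} f f-inj step close = record { vtx = f ; inj = f-inj ; adj = edge }
  where
  edge : ∀ i → col G (f i) (f (shiftBy 1 i)) ≡ c
  edge i with injectView i
  ... | last     rewrite shiftBy-1-fromℕ n = close
  ... | inject j rewrite shiftBy-1-inject₁ j = step j

module _ {N m c} {G : Colouring N} (C : CycleIn G c (suc m)) (x : Fin (suc m)) where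

  arc : ℕ → Fin N
  arc t = vtx C (shiftBy t x)

  arc-step : ∀ t → col G (arc t) (arc (suc t)) ≡ c
  arc-step t = subst (λ y → col G (arc t) (vtx C y) ≡ c)
    (trans (shiftBy-+ 1 t x) (cong (λ s → shiftBy s x) (+-comm t 1))) (adj C (shiftBy t x))

  arc-injective : ∀ {t t′} → t < suc m → t′ < suc m → arc t ≡ arc t′ → t ≡ t′
  arc-injective t<m t′<m e = shiftBy-injectiveˡ x t<m t′<m (inj C e)

  arc-cycle : ∀ {a b d} → d < suc m → ¬ a ≡ b → (∀ i → ¬ vtx C i ≡ a) → (∀ i → ¬ vtx C i ≡ b) →
    col G a b ≡ c → col G a (vtx C x) ≡ c → col G b (arc d) ≡ c → CycleIn G c (3 + d)
  arc-cycle {a} {b} {d} d<m a≢b a∉C b∉C ab a-x b-x+d = cycle-intro f f-inj step close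
    where
    f : Fin (3 + d) → Fin N
    f fz           = b
    f (fs fz)      = a
    f (fs (fs j))  = arc (toℕ j)

    step : ∀ i → col G (f (inject₁ i)) (f (fs i)) ≡ c
    step fz          = trans (symm G b a) ab
    step (fs fz)     = subst (λ y → col G a (vtx C y) ≡ c) (sym (shiftBy-0 x)) a-x
    step (fs (fs j)) rewrite toℕ-inject₁ j = arc-step (toℕ j)

    close : col G (f (fromℕ (2 + d))) b ≡ c
    close rewrite toℕ-fromℕ d = trans (symm G (arc d) b) b-x+d

    j<m : (j : Fin (suc d)) → toℕ j < suc m
    j<m j = ≤-<-trans (toℕ≤pred[n] j) d<m

    f-inj : Injective _≡_ _≡_ f
    f-inj {fz}          {fz}           _ = refl
    f-inj {fz}          {fs fz}        e = ⊥-elim (a≢b (sym e))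
    f-inj {fz}          {fs (fs j)}    e = ⊥-elim (b∉C _ (sym e))
    f-inj {fs fz}       {fz}           e = ⊥-elim (a≢b e)
    f-inj {fs fz}       {fs fz}        _ = refl
    f-inj {fs fz}       {fs (fs j)}    e = ⊥-elim (a∉C _ (sym e))
    f-inj {fs (fs j)}   {fz}           e = ⊥-elim (b∉C _ e)
    f-inj {fs (fs j)}   {fs fz}        e = ⊥-elim (a∉C _ e)
    f-inj {fs (fs j)}   {fs (fs j′)}   e =
      cong (λ i → fs (fs i)) (toℕ-injective (arc-injective (j<m j) (j<m j′) e))

isRed⇒red : ∀ {c} → isRed c ≡ true → c ≡ red
isRed⇒red {red} _ = refl

blueAdj-intro : ∀ {N} (G : Colouring N) {w u} → ¬ u ≡ w → isBlue (col G w u) ≡ true → blueAdj G w u ≡ true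
blueAdj-intro G {w} {u} u≢w wu-blue rewrite dec-no (u ≟ᶠ w) u≢w = wu-blue

count-blue-≤-blueDegInNB : ∀ {N m} (G : Colouring N) (v w : Fin N) (f : Fin m → Fin N) → Injective _≡_ _≡_ f →
  (∀ i → blueAdj G v (f i) ≡ true) → (∀ i → ¬ f i ≡ w) →
  count (λ i → isBlue (col G w (f i))) ≤ blueDegInNB G v w
count-blue-≤-blueDegInNB G v w f f-inj f⊆NB f≢w = count-≤-injective f f-inj λ i wfi-blue →
  subst (λ p → p ∧ blueAdj G w (f i) ≡ true) (sym (f⊆NB i)) (blueAdj-intro G (f≢w i) wfi-blue)

agreements+length≤blueDegInNB : ∀ {N m d} (G : Colouring N) → d < m → ¬ CycleIn G red (3 + d) →
  (C : CycleIn G red m) (v : Fin N) {a b : Fin N} → ¬ a ≡ b → col G a b ≡ red →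
  (∀ i → blueAdj G v (vtx C i) ≡ true) → (∀ i → ¬ vtx C i ≡ a) → (∀ i → ¬ vtx C i ≡ b) →
  count (λ x → eqB (isRed (col G a (vtx C x))) (isRed (col G b (vtx C (shiftBy d x))))) + m
    ≤ blueDegInNB G v a + blueDegInNB G v b
agreements+length≤blueDegInNB {m = suc m} {d} G d<m no-cycle C v {a} {b} a≢b ab C⊆NB a∉C b∉C = begin
  count (λ x → eqB (A x) (B x)) + suc m            ≡⟨ count-eqB-disjoint A B disjoint ⟩
  count (λ x → not (A x)) + count (λ x → not (B x)) ≤⟨ +-mono-≤ blue-a blue-b ⟩
  blueDegInNB G v a + blueDegInNB G v b            ∎
  where
  open ≤-Reasoning
  A B : Fin (suc m) → Bool
  A x = isRed (col G a (vtx C x))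
  B x = isRed (col G b (arc C x d))

  disjoint : ∀ x → A x ∧ B x ≡ false
  disjoint x with A x in ax | B x in bx
  ... | true  | true  = ⊥-elim (no-cycle (arc-cycle C x d<m a≢b a∉C b∉C ab (isRed⇒red ax) (isRed⇒red bx)))
  ... | true  | false = refl
  ... | false | _     = refl

  blue-a : count (λ x → not (A x)) ≤ blueDegInNB G v a
  blue-a = count-blue-≤-blueDegInNB G v a (vtx C) (inj C) C⊆NB a∉C

  blue-b : count (λ x → not (B x)) ≤ blueDegInNB G v b
  blue-b = count-blue-≤-blueDegInNB G v b (λ x → arc C x d) (λ e → shiftBy-injective d (inj C e))
    (λ x → C⊆NB (shiftBy d x)) (λ x → b∉C (shiftBy d x))

agreements≤ : ∀ s {E m dA dB j} → E + m ≤ dA + dB → dA < j → dB < j → m + (s + 2) ≡ 2 * j → E ≤ s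
agreements≤ s {E} {m} {dA} {dB} {j} E+m≤dA+dB dA<j dB<j m+s+2≡2j = +-cancelʳ-≤ (m + 2) E s (begin
  E + (m + 2)      ≡⟨ solve (E ∷ m ∷ []) ⟩
  (E + m) + 2      ≤⟨ +-monoˡ-≤ 2 E+m≤dA+dB ⟩
  (dA + dB) + 2    ≡⟨ solve (dA ∷ dB ∷ []) ⟩
  suc dA + suc dB  ≤⟨ +-mono-≤ dA<j dB<j ⟩
  j + j            ≡⟨ solve (j ∷ []) ⟩
  2 * j            ≡⟨ m+s+2≡2j ⟨
  m + (s + 2)      ≡⟨ solve (s ∷ m ∷ []) ⟩
  s + (m + 2)      ∎)
  where open ≤-Reasoning

lemma20 : (j k : ℕ) → k + 250 < j → 2 * j < 3 * k → j ≥ 212299 → k ≥ 141534 →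
  (G : Colouring (4 * j + 1)) →
  ¬ CycleIn G red (2 * k + 1) →
  ¬ WheelIn G blue (2 * j) →
  (v : Fin (4 * j + 1)) → (∀ w → blueDeg G w ≤ blueDeg G v) →
  (a b : Fin (4 * j + 1)) →
  blueAdj G v a ≡ true → blueAdj G v b ≡ true → ¬ a ≡ b → col G a b ≡ red →
  blueDegInNB G v a < j → blueDegInNB G v b < j →
  (C : CycleIn G red (2 * j ∸ 502)) →
  (∀ i → blueAdj G v (vtx C i) ≡ true) →
  (∀ i → ¬ vtx C i ≡ a) → (∀ i → ¬ vtx C i ≡ b) →
  let A = λ (i : Fin (2 * j ∸ 502)) → isRed (col G a (vtx C i))
      B = λ (i : Fin (2 * j ∸ 502)) → isRed (col G b (vtx C i))
  in count (λ x → eqB (A x) (B (shiftBy (2 * k ∸ 2) x))) ≤ 500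
     × count (λ x → eqB (B x) (A (shiftBy (2 * k ∸ 2) x))) ≤ 500
lemma20 j k k+250<j _ _ k≥141534 G no-C₂ₖ₊₁ _ v _ a b _ _ a≢b ab a-deg b-deg C C⊆NB a∉C b∉C =
    agreements≤ 500 (agreements+length≤blueDegInNB G d<m no-C₃₊d C v a≢b ab C⊆NB a∉C b∉C)
      a-deg b-deg m+502≡2j
  , agreements≤ 500 (agreements+length≤blueDegInNB G d<m no-C₃₊d C v (λ e → a≢b (sym e)) ba C⊆NB b∉C a∉C)
      b-deg a-deg m+502≡2j
  where
  d m : ℕ
  d = 2 * k ∸ 2
  m = 2 * j ∸ 502

  ba : col G b a ≡ red
  ba = trans (symm G b a) ab

  2k+502≤2j : 2 * k + 502 ≤ 2 * j
  2k+502≤2j = subst (_≤ 2 * j) double (*-monoʳ-≤ 2 k+250<j)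
    where
    double : 2 * suc (k + 250) ≡ 2 * k + 502
    double = solve (k ∷ [])

  m+502≡2j : m + 502 ≡ 2 * j
  m+502≡2j = m∸n+n≡m (≤-trans (m≤n+m 502 (2 * k)) 2k+502≤2j)

  2+d≡2k : 2 + d ≡ 2 * k
  2+d≡2k = m+[n∸m]≡n (*-monoʳ-≤ 2 (≤-trans (s≤s z≤n) k≥141534))

  d<m : d < m
  d<m = ≤-trans (subst (suc d ≤_) 2+d≡2k (n≤1+n (suc d))) (m+n≤o⇒m≤o∸n (2 * k) 2k+502≤2j)

  no-C₃₊d : ¬ CycleIn G red (3 + d)
  no-C₃₊d c = no-C₂ₖ₊₁ (subst (CycleIn G red) (trans (cong suc 2+d≡2k) (+-comm 1 (2 * k))) c)
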